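{- Let $G$ be a finite bipartite graph and $k\in\mathbb{N}$ such that $\mathcal{M}_k(G)$ is normal. Then $\mathcal{M}_k(H)$ is normal for every subgraph $H$ of $G$.
   Context: A $k$-matching of a graph is a set of exactly $k$ edges, no two sharing a vertex. For a graph $G=(V,E)$, $\mathcal{M}_k(G)=\operatorname{conv}\{\chi(M): M \text{ a } k\text{ -matching of } G\}\subseteq\mathbb{R}^E$, where $\chi(M)$ is the $0/1$ indicator vector of $M$. A polytope $P$ is normal if for every positive integer $t$, every integer point of $tP=\{tx:x\in P\}$ is a sum of $t$ integer points of $P$. -}

module Defs where

open import Data.Nat using (ℕ; zero; suc; _≥_)
open import Data.Integer as ℤ using (ℤ; +_)
open import Data.Bool using (Bool; true; false; if_then_else_)
open import Data.Fin using (Fin)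
open import Data.Fin.Subset using (Subset; _∈_; ∣_∣)
open import Data.Vec using (lookup)
open import Data.List using (List; []; _∷_; length; map; foldr)
open import Data.List.Relation.Unary.All using (All)
open import Data.Product using (Σ; ∃; ∃-syntax; _×_; _,_; proj₁; proj₂)
open import Data.Sum using (_⊎_)
open import Relation.Binary.PropositionalEquality using (_≡_; _≢_)
open import Function.Definitions using (Injective)

record Graph : Set where
  field
    nV   : ℕ
    nE   : ℕ
    ends : Fin nE → Fin nV × Fin nV
open Graph public

Bipartite : Graph → Set
Bipartite G = Σ (Fin (nV G) → Bool) λ c →
  ∀ e → c (proj₁ (ends G e)) ≢ c (proj₂ (ends G e))

Simple : Graph → Set
Simple G =
  (∀ e → proj₁ (ends G e) ≢ proj₂ (ends G e)) ×
  (∀ e e' → (ends G e ≡ ends G e' ⊎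
             (proj₁ (ends G e) ≡ proj₂ (ends G e') × proj₂ (ends G e) ≡ proj₁ (ends G e')))
          → e ≡ e')

-- H is (isomorphic to) a subgraph of G: injective vertex map f and
-- injective edge map g with ends_G (g e) = (f a , f b) when ends_H e = (a , b).
record SubgraphOf (H G : Graph) : Set where
  field
    vmap     : Fin (nV H) → Fin (nV G)
    emap     : Fin (nE H) → Fin (nE G)
    vmap-inj : Injective _≡_ _≡_ vmap
    emap-inj : Injective _≡_ _≡_ emap
    compat   : ∀ e → ends G (emap e) ≡ (vmap (proj₁ (ends H e)) , vmap (proj₂ (ends H e)))

VertexDisjoint : (G : Graph) → Fin (nE G) → Fin (nE G) → Set
VertexDisjoint G e e' =
  (proj₁ (ends G e) ≢ proj₁ (ends G e')) × (proj₁ (ends G e) ≢ proj₂ (ends G e')) ×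
  (proj₂ (ends G e) ≢ proj₁ (ends G e')) × (proj₂ (ends G e) ≢ proj₂ (ends G e'))

IsKMatching : (G : Graph) → ℕ → Subset (nE G) → Set
IsKMatching G k M = (∣ M ∣ ≡ k) ×
  (∀ e e' → e ∈ M → e' ∈ M → e ≢ e' → VertexDisjoint G e e')

KMatching : Graph → ℕ → Set
KMatching G k = Σ (Subset (nE G)) (IsKMatching G k)

χ : ∀ {m} → Subset m → Fin m → ℕ
χ M e = if lookup M e then 1 else 0

χsum : (G : Graph) {k : ℕ} → List (KMatching G k) → Fin (nE G) → ℕ
χsum G L e = foldr (λ M acc → χ (proj₁ M) e Data.Nat.+ acc) 0 L

ZVec : Graph → Set
ZVec G = Fin (nE G) → ℤ

-- Since M_k(G) is the convex hull
-- of finitely many rational points and x is rational, x ∈ t·M_k(G) iff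
-- x = t · Σ λ_M χ(M) with rational λ_M ≥ 0 summing to 1; writing the λ_M
-- over a common denominator d ≥ 1, this is: there is a list (multiset) of
-- d k-matchings M_1..M_d with d · x = t · Σ_i χ(M_i).
InDilate : (G : Graph) (k t : ℕ) → ZVec G → Set
InDilate G k t x = Σ ℕ λ d → (d ≥ 1) × Σ (List (KMatching G k)) λ L →
  (length L ≡ d) × (∀ e → (+ d) ℤ.* x e ≡ (+ t) ℤ.* (+ χsum G L e))

vsum : (G : Graph) → List (ZVec G) → ZVec G
vsum G ys e = foldr (λ y acc → y e ℤ.+ acc) (+ 0) ys

NormalMk : Graph → ℕ → Set
NormalMk G k = ∀ (t : ℕ) → t ≥ 1 → ∀ (x : ZVec G) → InDilate G k t x →
  Σ (List (ZVec G)) λ ys → (length ys ≡ t) × All (InDilate G k 1) ys ×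
    (∀ e → x e ≡ vsum G ys e)

{-# OPTIONS --safe #-}
-- Matchings of H are the matchings of G that use only edges of H, so
-- extension by zero identifies M_k(H) with the face of M_k(G) on which the
-- coordinates outside H vanish (a face because M_k(G) lies in the
-- nonnegative orthant).  An integer point x of t·M_k(H), extended by zero,
-- is an integer point of t·M_k(G); normality of M_k(G) writes it as a sum
-- of t integer points of M_k(G).  These are nonnegative and sum to zero
-- outside H, so each vanishes there and restricts to an integer point of
-- M_k(H).
module Submission where

open import Defs
open import Data.Nat as ℕ using (ℕ; zero; suc; z≤n)
open import Data.Nat.Properties using (m+n≡0⇒m≡0; m+n≡0⇒n≡0)
open import Data.Integer as ℤ using (+_; 0ℤ; +≤+; +<+)
open import Data.Integer.Properties
  using ( *-zeroʳ; pos-*; *-cancelˡ-≤-pos; *-cancelˡ-≡; +-injective; +-mono-≤; ≤-refl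
        ; module ≤-Reasoning)
open import Data.Bool using (if_then_else_)
open import Data.Fin using (Fin; zero; suc)
open import Data.Fin.Properties using (_≟_; any?; suc-injective; 0≢1+n)
open import Data.Fin.Subset using (Subset; inside; outside; _∈_; _∉_; _-_; ∣_∣; Empty)
open import Data.Fin.Subset.Properties
  using (Empty-unique; ∣⊥∣≡0; p─⊥≡p; p─q⊆p; x∈p∧x≢y⇒x∈p-y; ⊆-antisym)
open import Data.Vec using (_∷_; here; there; lookup; tabulate)
open import Data.Vec.Properties
  using ([]=⇒lookup; lookup⇒[]=; lookup∘tabulate; tabulate∘lookup; tabulate-cong)
open import Data.List using (List; []; _∷_; length; map)
open import Data.List.Properties using (length-map)
open import Data.List.Relation.Unary.All as All using (All; []; _∷_)
open import Data.List.Relation.Unary.All.Properties using (map⁺)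
open import Data.Product using (∃; _×_; _,_; proj₁; proj₂; uncurry)
open import Relation.Nullary using (¬_; Dec; yes; no; contradiction)
open import Relation.Binary.PropositionalEquality
  using (_≡_; _≢_; refl; sym; trans; cong; cong₂; subst₂; module ≡-Reasoning)
open import Function using (_∘_)
open import Function.Definitions using (Injective)

x∉p-x : ∀ {n} {x : Fin n} {p : Subset n} → x ∉ p - x
x∉p-x {x = zero}  {_ ∷ _} ()
x∉p-x {x = suc x} {_ ∷ _} (there x∈p-x) = x∉p-x x∈p-x

x∈p⇒∣p∣≡1+∣p-x∣ : ∀ {n} {x : Fin n} {p : Subset n} → x ∈ p → ∣ p ∣ ≡ suc ∣ p - x ∣
x∈p⇒∣p∣≡1+∣p-x∣ {p = inside  ∷ p} here        = cong (suc ∘ ∣_∣) (sym (p─⊥≡p p))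
x∈p⇒∣p∣≡1+∣p-x∣ {p = inside  ∷ p} (there x∈p) = cong suc (x∈p⇒∣p∣≡1+∣p-x∣ x∈p)
x∈p⇒∣p∣≡1+∣p-x∣ {p = outside ∷ p} (there x∈p) = x∈p⇒∣p∣≡1+∣p-x∣ x∈p

module _ {n m : ℕ} (f : Fin n → Fin m) where

  Range : Fin m → Set
  Range g = ∃ λ e → f e ≡ g

  range? : ∀ g → Dec (Range g)
  range? g = any? (λ e → f e ≟ g)

  extend : {A : Set} → (Fin n → A) → A → Fin m → A
  extend x a g with range? g
  ... | yes (e , _) = x e
  ... | no _        = a

  extend-hit : Injective _≡_ _≡_ f → ∀ {A : Set} (x : Fin n → A) a e → extend x a (f e) ≡ x e
  extend-hit f-inj x a e with range? (f e)
  ... | yes (e′ , fe′≡fe) = cong x (f-inj fe′≡fe)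
  ... | no ∉range         = contradiction (e , refl) ∉range

  extend-miss : ∀ {A : Set} (x : Fin n → A) a {g} → ¬ Range g → extend x a g ≡ a
  extend-miss x a {g} ∉range with range? g
  ... | yes ∈range = contradiction ∈range ∉range
  ... | no _       = refl

  preimage : Subset m → Subset n
  preimage p = tabulate (lookup p ∘ f)

  image : Subset n → Subset m
  image p = tabulate (extend (lookup p) outside)

  ∈-preimage⁺ : ∀ {p e} → f e ∈ p → e ∈ preimage p
  ∈-preimage⁺ {e = e} fe∈p = lookup⇒[]= e _ (trans (lookup∘tabulate _ e) ([]=⇒lookup fe∈p))

  ∈-preimage⁻ : ∀ {p e} → e ∈ preimage p → f e ∈ p
  ∈-preimage⁻ {p} {e} e∈ = lookup⇒[]= (f e) p (trans (sym (lookup∘tabulate _ e)) ([]=⇒lookup e∈))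

  ∈-image⁻ : ∀ {p g} → g ∈ image p → ∃ λ e → f e ≡ g × e ∈ p
  ∈-image⁻ {p} {g} g∈ = from-extend (trans (sym (lookup∘tabulate _ g)) ([]=⇒lookup g∈))
    where
    from-extend : extend (lookup p) outside g ≡ inside → ∃ λ e → f e ≡ g × e ∈ p
    from-extend x≡inside with range? g
    ... | yes (e , fe≡g) = e , fe≡g , lookup⇒[]= e p x≡inside
    from-extend () | no _

  lookup-image-hit : Injective _≡_ _≡_ f → ∀ p e → lookup (image p) (f e) ≡ lookup p e
  lookup-image-hit f-inj p e =
    trans (lookup∘tabulate _ (f e)) (extend-hit f-inj (lookup p) outside e)

  lookup-image-miss : ∀ p {g} → ¬ Range g → lookup (image p) g ≡ outside
  lookup-image-miss p {g} ∉range =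
    trans (lookup∘tabulate _ g) (extend-miss (lookup p) outside ∉range)

  χ-image-hit : Injective _≡_ _≡_ f → ∀ p e → χ (image p) (f e) ≡ χ p e
  χ-image-hit f-inj p e = cong (if_then 1 else 0) (lookup-image-hit f-inj p e)

  χ-image-miss : ∀ p {g} → ¬ Range g → χ (image p) g ≡ 0
  χ-image-miss p ∉range = cong (if_then 1 else 0) (lookup-image-miss p ∉range)

  χ-preimage : ∀ p e → χ (preimage p) e ≡ χ p (f e)
  χ-preimage p e = cong (if_then 1 else 0) (lookup∘tabulate _ e)

  preimage-image : Injective _≡_ _≡_ f → ∀ p → preimage (image p) ≡ p
  preimage-image f-inj p = trans (tabulate-cong (lookup-image-hit f-inj p)) (tabulate∘lookup p)

  preimage-─ : ∀ {p x} → (∀ e → f e ≢ x) → preimage (p - x) ≡ preimage p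
  preimage-─ {p} {x} fe≢x = ⊆-antisym
    (λ e∈ → ∈-preimage⁺ {p} (p─q⊆p p _ (∈-preimage⁻ {p - x} e∈)))
    (λ {e} e∈ → ∈-preimage⁺ {p - x} (x∈p∧x≢y⇒x∈p-y (∈-preimage⁻ {p} e∈) (fe≢x e)))

_⊆-range_ : ∀ {n m} → Subset m → (Fin n → Fin m) → Set
p ⊆-range f = ∀ {g} → g ∈ p → Range f g

χ≡0⇒⊆-range : ∀ {n m} (f : Fin n → Fin m) p → (∀ {g} → ¬ Range f g → χ p g ≡ 0) → p ⊆-range f
χ≡0⇒⊆-range f p χ≡0 {g} g∈p with range? f g
... | yes ∈range = ∈range
... | no ∉range with () ← trans (cong (if_then 1 else 0) (sym ([]=⇒lookup g∈p))) (χ≡0 ∉range)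

⊆-range-suc : ∀ {n m} {f : Fin (suc n) → Fin m} {p} →
              p ⊆-range f → f zero ∉ p → p ⊆-range (f ∘ suc)
⊆-range-suc p⊆ f0∉p g∈p with p⊆ g∈p
... | zero  , refl  = contradiction g∈p f0∉p
... | suc e , fe≡g  = e , fe≡g

∣preimage∣ : ∀ {n m} (f : Fin n → Fin m) → Injective _≡_ _≡_ f →
             ∀ p → p ⊆-range f → ∣ preimage f p ∣ ≡ ∣ p ∣
∣preimage∣ {zero} {m} f _ p p⊆ = sym (trans (cong ∣_∣ (Empty-unique p-empty)) (∣⊥∣≡0 m))
  where
  p-empty : Empty p
  p-empty (g , g∈p) with p⊆ g∈p
  ... | () , _
∣preimage∣ {suc n} f f-inj p p⊆ with lookup p (f zero) in f0∈?
... | inside = begin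
  suc ∣ preimage (f ∘ suc) p ∣        ≡⟨ cong (suc ∘ ∣_∣) (preimage-─ (f ∘ suc) {p} fsuc≢x) ⟨
  suc ∣ preimage (f ∘ suc) (p - x) ∣  ≡⟨ cong suc (∣preimage∣ _ fsuc-inj (p - x) p-x⊆range) ⟩
  suc ∣ p - x ∣                       ≡⟨ x∈p⇒∣p∣≡1+∣p-x∣ (lookup⇒[]= x p f0∈?) ⟨
  ∣ p ∣                               ∎
  where
  open ≡-Reasoning
  x = f zero
  fsuc-inj : Injective _≡_ _≡_ (f ∘ suc)
  fsuc-inj = suc-injective ∘ f-inj
  fsuc≢x : ∀ e → f (suc e) ≢ x
  fsuc≢x _ = 0≢1+n ∘ sym ∘ f-inj
  p-x⊆range : (p - x) ⊆-range (f ∘ suc)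
  p-x⊆range = ⊆-range-suc (p⊆ ∘ p─q⊆p p _) x∉p-x
... | outside = ∣preimage∣ (f ∘ suc) (suc-injective ∘ f-inj) p (⊆-range-suc p⊆ f0∉p)
  where
  f0∉p : f zero ∉ p
  f0∉p f0∈p with () ← trans (sym f0∈?) ([]=⇒lookup f0∈p)

∣image∣ : ∀ {n m} (f : Fin n → Fin m) → Injective _≡_ _≡_ f → ∀ p → ∣ image f p ∣ ≡ ∣ p ∣
∣image∣ f f-inj p = begin
  ∣ image f p ∣                ≡⟨ sym (∣preimage∣ f f-inj (image f p) image⊆range) ⟩
  ∣ preimage f (image f p) ∣   ≡⟨ cong ∣_∣ (preimage-image f f-inj p) ⟩
  ∣ p ∣                        ∎
  where
  open ≡-Reasoning
  image⊆range : image f p ⊆-range f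
  image⊆range g∈ with ∈-image⁻ f {p} g∈
  ... | e , fe≡g , _ = e , fe≡g

-- VertexDisjoint G e e′ unfolds to DisjointEnds (ends G e) (ends G e′).
DisjointEnds : {A : Set} → A × A → A × A → Set
DisjointEnds (a , b) (a′ , b′) = (a ≢ a′) × (a ≢ b′) × (b ≢ a′) × (b ≢ b′)

module _ {A B : Set} (v : A → B) {a b a′ b′ : A} where

  DisjointEnds-map⁺ : Injective _≡_ _≡_ v →
                      DisjointEnds (a , b) (a′ , b′) → DisjointEnds (v a , v b) (v a′ , v b′)
  DisjointEnds-map⁺ v-inj (p , q , r , s) = p ∘ v-inj , q ∘ v-inj , r ∘ v-inj , s ∘ v-inj

  DisjointEnds-map⁻ : DisjointEnds (v a , v b) (v a′ , v b′) → DisjointEnds (a , b) (a′ , b′)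
  DisjointEnds-map⁻ (p , q , r , s) = p ∘ cong v , q ∘ cong v , r ∘ cong v , s ∘ cong v

+-nonneg-≡0 : ∀ {i j} → 0ℤ ℤ.≤ i → 0ℤ ℤ.≤ j → i ℤ.+ j ≡ 0ℤ → i ≡ 0ℤ × j ≡ 0ℤ
+-nonneg-≡0 {+ a} (+≤+ _) (+≤+ _) a+b≡0 =
  cong +_ (m+n≡0⇒m≡0 a (+-injective a+b≡0)) , cong +_ (m+n≡0⇒n≡0 a (+-injective a+b≡0))

InDilate-nonneg : ∀ {G k} t {y} → InDilate G k t y → ∀ g → 0ℤ ℤ.≤ y g
InDilate-nonneg {G} t {y} (d , d≥1 , L , _ , eq) g =
  *-cancelˡ-≤-pos 0ℤ (y g) (+ d) {{ℤ.positive (+<+ d≥1)}} (begin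
    + d ℤ.* 0ℤ             ≡⟨ *-zeroʳ (+ d) ⟩
    0ℤ                     ≤⟨ +≤+ z≤n ⟩
    + (t ℕ.* χsum G L g)   ≡⟨ pos-* t (χsum G L g) ⟩
    + t ℤ.* + χsum G L g   ≡⟨ eq g ⟨
    + d ℤ.* y g            ∎)
  where open ≤-Reasoning

module _ (G : Graph) where

  vsum-nonneg : ∀ ys → All (λ y → ∀ g → 0ℤ ℤ.≤ y g) ys → ∀ g → 0ℤ ℤ.≤ vsum G ys g
  vsum-nonneg []       []           g = ≤-refl
  vsum-nonneg (y ∷ ys) (y≥0 ∷ ys≥0) g = +-mono-≤ (y≥0 g) (vsum-nonneg ys ys≥0 g)

  nonneg-vsum≡0⇒summands≡0 : ∀ {Z : Fin (nE G) → Set} ys →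
    All (λ y → ∀ g → 0ℤ ℤ.≤ y g) ys → (∀ {g} → Z g → vsum G ys g ≡ 0ℤ) →
    All (λ y → ∀ {g} → Z g → y g ≡ 0ℤ) ys
  nonneg-vsum≡0⇒summands≡0     []       []           _     = []
  nonneg-vsum≡0⇒summands≡0 {Z} (y ∷ ys) (y≥0 ∷ ys≥0) sum≡0 =
    (proj₁ ∘ split) ∷ nonneg-vsum≡0⇒summands≡0 ys ys≥0 (proj₂ ∘ split)
    where
    split : ∀ {g} → Z g → y g ≡ 0ℤ × vsum G ys g ≡ 0ℤ
    split {g} z = +-nonneg-≡0 (y≥0 g) (vsum-nonneg ys ys≥0 g) (sum≡0 z)

vsum-∘ : ∀ H G (h : Fin (nE H) → Fin (nE G)) ys e →
         vsum H (map (_∘ h) ys) e ≡ vsum G ys (h e)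
vsum-∘ H G h []       e = refl
vsum-∘ H G h (y ∷ ys) e = cong (ℤ._+_ (y (h e))) (vsum-∘ H G h ys e)

module Embedding {H G : Graph} (sub : SubgraphOf H G) where
  open SubgraphOf sub

  disjoint-emap⁺ : ∀ {e e′} → VertexDisjoint H e e′ → VertexDisjoint G (emap e) (emap e′)
  disjoint-emap⁺ {e} {e′} =
    subst₂ DisjointEnds (sym (compat e)) (sym (compat e′)) ∘ DisjointEnds-map⁺ vmap vmap-inj

  disjoint-emap⁻ : ∀ {e e′} → VertexDisjoint G (emap e) (emap e′) → VertexDisjoint H e e′
  disjoint-emap⁻ {e} {e′} = DisjointEnds-map⁻ vmap ∘ subst₂ DisjointEnds (compat e) (compat e′)

  module _ {k : ℕ} where

    matching-image : KMatching H k → KMatching G k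
    matching-image (M , |M|≡k , disjoint) =
      image emap M , trans (∣image∣ emap emap-inj M) |M|≡k , disjoint′
      where
      disjoint′ : ∀ g g′ → g ∈ image emap M → g′ ∈ image emap M → g ≢ g′ → VertexDisjoint G g g′
      disjoint′ g g′ g∈ g′∈ g≢g′ with ∈-image⁻ emap {M} g∈ | ∈-image⁻ emap {M} g′∈
      ... | e , refl , e∈M | e′ , refl , e′∈M =
        disjoint-emap⁺ (disjoint e e′ e∈M e′∈M (g≢g′ ∘ cong emap))

    Supported : KMatching G k → Set
    Supported M = proj₁ M ⊆-range emap

    matching-preimage : (M : KMatching G k) → Supported M → KMatching H k
    matching-preimage (M , |M|≡k , disjoint) M⊆range =
      preimage emap M , trans (∣preimage∣ emap emap-inj M M⊆range) |M|≡k ,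
      λ e e′ e∈ e′∈ e≢e′ → disjoint-emap⁻
        (disjoint _ _ (∈-preimage⁻ emap {M} e∈) (∈-preimage⁻ emap {M} e′∈) (e≢e′ ∘ emap-inj))

    χsum-image-hit : ∀ L e → χsum G (map matching-image L) (emap e) ≡ χsum H L e
    χsum-image-hit []      e = refl
    χsum-image-hit (M ∷ L) e =
      cong₂ ℕ._+_ (χ-image-hit emap emap-inj (proj₁ M) e) (χsum-image-hit L e)

    χsum-image-miss : ∀ L {g} → ¬ Range emap g → χsum G (map matching-image L) g ≡ 0
    χsum-image-miss []      ∉range = refl
    χsum-image-miss (M ∷ L) ∉range =
      cong₂ ℕ._+_ (χ-image-miss emap (proj₁ M) ∉range) (χsum-image-miss L ∉range)

    InDilate-extend : ∀ t {x} → InDilate H k t x → InDilate G k t (extend emap x 0ℤ)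
    InDilate-extend t {x} (d , d≥1 , L , |L|≡d , eq) =
      d , d≥1 , map matching-image L , trans (length-map _ L) |L|≡d , eq′
      where
      eq′ : ∀ g → + d ℤ.* extend emap x 0ℤ g ≡ + t ℤ.* + χsum G (map matching-image L) g
      eq′ g with range? emap g
      ... | yes (e , refl) = trans (eq e) (cong (λ c → + t ℤ.* + c) (sym (χsum-image-hit L e)))
      ... | no ∉range      = begin
        + d ℤ.* 0ℤ                                 ≡⟨ *-zeroʳ (+ d) ⟩
        0ℤ                                         ≡⟨ *-zeroʳ (+ t) ⟨
        + t ℤ.* 0ℤ                                 ≡⟨ cong (λ c → + t ℤ.* + c) χsum≡0 ⟨
        + t ℤ.* + χsum G (map matching-image L) g  ∎
        where
        open ≡-Reasoning
        χsum≡0 = χsum-image-miss L ∉range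

    χsum≡0⇒supported : ∀ L → (∀ {g} → ¬ Range emap g → χsum G L g ≡ 0) → All Supported L
    χsum≡0⇒supported []      _     = []
    χsum≡0⇒supported (M ∷ L) sum≡0 =
      χ≡0⇒⊆-range emap (proj₁ M) (λ ∉range → m+n≡0⇒m≡0 _ (sum≡0 ∉range)) ∷
      χsum≡0⇒supported L (λ ∉range → m+n≡0⇒n≡0 (χ (proj₁ M) _) (sum≡0 ∉range))

    restrict : ∀ {L} → All Supported L → List (KMatching H k)
    restrict {[]}    []       = []
    restrict {M ∷ _} (s ∷ ss) = matching-preimage M s ∷ restrict ss

    length-restrict : ∀ {L} (ss : All Supported L) → length (restrict ss) ≡ length L
    length-restrict []       = refl
    length-restrict (_ ∷ ss) = cong suc (length-restrict ss)

    χsum-restrict : ∀ {L} (ss : All Supported L) e → χsum H (restrict ss) e ≡ χsum G L (emap e)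
    χsum-restrict {[]}    []       e = refl
    χsum-restrict {M ∷ _} (_ ∷ ss) e =
      cong₂ ℕ._+_ (χ-preimage emap (proj₁ M) e) (χsum-restrict ss e)

    InDilate-restrict : ∀ t {y} .{{_ : ℕ.NonZero t}} → InDilate G k t y →
                        (∀ {g} → ¬ Range emap g → y g ≡ 0ℤ) → InDilate H k t (y ∘ emap)
    InDilate-restrict t {y} (d , d≥1 , L , |L|≡d , eq) y≡0 =
      d , d≥1 , restrict supported , trans (length-restrict supported) |L|≡d ,
      λ e → trans (eq (emap e)) (cong (λ c → + t ℤ.* + c) (sym (χsum-restrict supported e)))
      where
      χsum≡0 : ∀ {g} → ¬ Range emap g → χsum G L g ≡ 0
      χsum≡0 {g} ∉range = +-injective (*-cancelˡ-≡ (+ t) _ 0ℤ (begin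
        + t ℤ.* + χsum G L g  ≡⟨ eq g ⟨
        + d ℤ.* y g           ≡⟨ cong (+ d ℤ.*_) (y≡0 ∉range) ⟩
        + d ℤ.* 0ℤ            ≡⟨ *-zeroʳ (+ d) ⟩
        0ℤ                    ≡⟨ *-zeroʳ (+ t) ⟨
        + t ℤ.* 0ℤ            ∎))
        where open ≡-Reasoning
      supported : All Supported L
      supported = χsum≡0⇒supported L χsum≡0

lemma4p1 : (G : Graph) → Simple G → Bipartite G → (k : ℕ) → NormalMk G k →
    (H : Graph) → SubgraphOf H G → NormalMk H k
lemma4p1 G _ _ k normal H sub t t≥1 x x∈tP =
  let x′ = extend emap x 0ℤ
      ys , |ys|≡t , ys∈P , x′≡Σys = normal t t≥1 x′ (InDilate-extend t x∈tP)
      ys≡0 = nonneg-vsum≡0⇒summands≡0 G {¬_ ∘ Range emap} ys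
               (All.map (InDilate-nonneg 1) ys∈P)
               (λ ∉range → trans (sym (x′≡Σys _)) (extend-miss emap x 0ℤ ∉range))
  in map (_∘ emap) ys ,
     trans (length-map _ ys) |ys|≡t ,
     map⁺ (All.zipWith (uncurry (InDilate-restrict 1)) (ys∈P , ys≡0)) ,
     λ e → begin
       x e                           ≡⟨ extend-hit emap emap-inj x 0ℤ e ⟨
       x′ (emap e)                   ≡⟨ x′≡Σys (emap e) ⟩
       vsum G ys (emap e)            ≡⟨ vsum-∘ H G emap ys e ⟨
       vsum H (map (_∘ emap) ys) e   ∎
  where
  open SubgraphOf sub
  open Embedding sub
  open ≡-Reasoning
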